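{- The only nontrivial blocks of $AQ_4$ containing the vertex $0000$ are $\{0000,0100\}$, $\{0000,0100,0011,0111\}$ and $\{0000,0100,0011,0111,1001,1010,1101,1110\}$.
   Context: $AQ_4$ is the graph with vertex set $\mathbb{Z}_2^4$ (vectors written as bit strings) in which $x,y$ are adjacent iff $x+y\in S$, where $S=\{1000,0100,0010,0001,0011,0111,1111\}$. A block of a vertex-transitive graph $X$ is a subset $\Delta$ of vertices such that for every $g\in\mathrm{Aut}(X)$ either $\Delta^g=\Delta$ or $\Delta^g\cap\Delta=\emptyset$; it is nontrivial if $1<|\Delta|<|V(X)|$. -}

module Defs where

open import Data.Bool using (Bool; true; false; _xor_)
open import Data.Vec using (Vec; []; _∷_; zipWith)
open import Data.List using (List; []; _∷_; filter; length; map; concatMap)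
open import Data.List.Membership.Propositional using (_∈_)
open import Data.Nat using (ℕ; _<_)
open import Data.Product using (Σ; _×_; _,_)
open import Data.Sum using (_⊎_)
open import Data.Empty using (⊥)
open import Relation.Nullary using (¬_)
open import Relation.Binary.PropositionalEquality using (_≡_)
open import Function.Bundles using (_↔_; _⇔_; Inverse)

-- vertices of AQ_4: Z_2^4 as bit strings (leftmost bit first)
V : Set
V = Vec Bool 4

_⊕_ : V → V → V
_⊕_ = zipWith _xor_

b : Bool → Bool → Bool → Bool → V
b w x y z = w ∷ x ∷ y ∷ z ∷ []

bits : List Bool
bits = false ∷ true ∷ []

allV : List V
allV = concatMap (λ w → concatMap (λ x → concatMap (λ y → map (λ z → b w x y z) bits) bits) bits) bits

S : List V
S = b true false false false ∷ b false true false false ∷ b false false true false ∷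
    b false false false true ∷ b false false true true ∷ b false true true true ∷
    b true true true true ∷ []

Adj : V → V → Set
Adj x y = (x ⊕ y) ∈ S

record Aut : Set where
  field
    perm     : V ↔ V
    preserves : ∀ x y → Adj x y ⇔ Adj (Inverse.to perm x) (Inverse.to perm y)

Subset : Set
Subset = V → Bool

_∈ₛ_ : V → Subset → Set
v ∈ₛ Δ = Δ v ≡ true

_∈img[_,_] : V → Subset → Aut → Set
y ∈img[ Δ , g ] = Σ V λ x → (x ∈ₛ Δ) × (Inverse.to (Aut.perm g) x ≡ y)

card : Subset → ℕ
card Δ = length (filter (λ v → Data.Bool._≟_ (Δ v) true) allV)
  where import Data.Bool

ImgEq : Subset → Aut → Set
ImgEq Δ g = ∀ y → (y ∈img[ Δ , g ]) ⇔ (y ∈ₛ Δ)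

ImgDisj : Subset → Aut → Set
ImgDisj Δ g = ∀ y → y ∈img[ Δ , g ] → y ∈ₛ Δ → ⊥

IsBlock : Subset → Set
IsBlock Δ = ∀ (g : Aut) → ImgEq Δ g ⊎ ImgDisj Δ g

IsNontrivialBlock : Subset → Set
IsNontrivialBlock Δ = IsBlock Δ × (1 < card Δ) × (card Δ < 16)

_≐_ : Subset → List V → Set
Δ ≐ L = ∀ v → (v ∈ₛ Δ) ⇔ (v ∈ L)

B2 B4 B8 : List V
B2 = b false false false false ∷ b false true false false ∷ []
B4 = b false false false false ∷ b false true false false ∷ b false false true true ∷ b false true true true ∷ []
B8 = b false false false false ∷ b false true false false ∷ b false false true true ∷ b false true true true ∷
     b true false false true ∷ b true false true false ∷ b true true false true ∷ b true true true false ∷ []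

module Submission where

-- (⇐) AQ₄ is a Cayley graph of ℤ₂⁴, so translations are automorphisms; hence an
-- invariant relation is the difference relation  x ⊕ y ∈ L  of its neighbourhood L of 0.
-- Purely graph-theoretic relations are invariant by construction: heavy edges (edges with
-- two distinct non-adjacent common neighbours), twins (two heavy steps), Same₄ (twin or
-- heavy), light edges (edges not in Same₄) and Same₈ (Same₄ or two light steps).  Their
-- difference sets are computed to be B2, B4 and B8.  These sets are ⊕-closed, so the
-- relations are equivalences, and the class of 0 of an invariant equivalence is a block.
--
-- (⇒) A block through 0 is closed under ⊕ (translate by its points) and is fixed by
-- automorphisms fixing 0.  Three explicit involutions fixing 0 cut V into six orbits, so
-- the block is one of 32 orbit unions, and checking these shows that the ⊕-closed ones of
-- size strictly between 1 and 16 are B2, B4 and B8.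

open import Defs
open import Data.Bool using (true; false)
open import Data.Product using (_×_)
open import Data.Sum using (_⊎_)
open import Function.Bundles using (_⇔_)

open import Data.Bool using (Bool; not; _∧_; _∨_; _xor_)
import Data.Bool as Bool
open import Data.Bool.Properties using (T-≡; ∧-conicalˡ; ∧-conicalʳ; ⇔→≡; xor-assoc; xor-comm; xor-same)
open import Data.Nat using (zero; suc; _<_; _<ᵇ_; _≤ᵇ_)
open import Data.Nat.Properties using (<ᵇ⇒<; ≤ᵇ⇒≤; <⇒≱)
open import Data.Vec using (Vec; _∷_; [])
open import Data.Vec.Properties using (zipWith-assoc; zipWith-comm; ≡-dec)
open import Data.List using (List; []; _∷_; length)
open import Data.List.Properties using (filter-≐)
open import Data.List.Membership.Propositional using (_∈_)
open import Data.Product using (Σ; _,_)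
open import Data.Sum using (inj₁; inj₂)
import Data.Sum as Sum
open import Data.Empty using (⊥-elim)
open import Function using (_∘_)
open import Function.Bundles using (Inverse; Equivalence; mk⇔; mk↔ₛ′)
open import Relation.Nullary using (Dec)
open import Relation.Nullary.Decidable using (⌊_⌋; toWitness; fromWitness)
open import Relation.Binary.PropositionalEquality
open ≡-Reasoning

_≟ᵥ_ : (x y : V) → Dec (x ≡ y)
_≟ᵥ_ = ≡-dec Bool._≟_

open import Data.List.Membership.DecPropositional _≟ᵥ_ using (_∈?_)

bool-ext : ∀ {x y} → (x ≡ true → y ≡ true) → (y ≡ true → x ≡ true) → x ≡ y
bool-ext f g = ⇔→≡ (mk⇔ f g)

false≢true : false ≢ true
false≢true ()

∨-elim : ∀ {x y} → x ∨ y ≡ true → x ≡ true ⊎ y ≡ true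
∨-elim {true} _ = inj₁ refl
∨-elim {false} h = inj₂ h

∨-introˡ : ∀ {x} y → x ≡ true → x ∨ y ≡ true
∨-introˡ _ refl = refl

∨-introʳ : ∀ x {y} → y ≡ true → x ∨ y ≡ true
∨-introʳ true _ = refl
∨-introʳ false h = h

∧-intro : ∀ {x y} → x ≡ true → y ≡ true → x ∧ y ≡ true
∧-intro refl refl = refl

_⇒ᵇ_ : Bool → Bool → Bool
true ⇒ᵇ y = y
false ⇒ᵇ _ = true

⇒ᵇ-elim : ∀ {x y} → (x ⇒ᵇ y) ≡ true → x ≡ true → y ≡ true
⇒ᵇ-elim h refl = h

⇒ᵇ-intro : ∀ x {y} → (x ≡ true → y ≡ true) → (x ⇒ᵇ y) ≡ true
⇒ᵇ-intro true f = f refl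
⇒ᵇ-intro false _ = refl

infix 4 _≡ᵇ_
_≡ᵇ_ : Bool → Bool → Bool
true ≡ᵇ y = y
false ≡ᵇ y = not y

≡ᵇ-sound : ∀ {x y} → (x ≡ᵇ y) ≡ true → x ≡ y
≡ᵇ-sound {true} {true} _ = refl
≡ᵇ-sound {false} {false} _ = refl

_∈ᵇ_ : V → List V → Bool
v ∈ᵇ L = ⌊ v ∈? L ⌋

∈ᵇ-sound : ∀ {v L} → v ∈ᵇ L ≡ true → v ∈ L
∈ᵇ-sound h = toWitness (Equivalence.from T-≡ h)

∈ᵇ-complete : ∀ {v L} → v ∈ L → v ∈ᵇ L ≡ true
∈ᵇ-complete m = Equivalence.to T-≡ (fromWitness m)

_=ᵥ_ : V → V → Bool
x =ᵥ y = ⌊ x ≟ᵥ y ⌋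

=ᵥ-sound : ∀ {x y} → (x =ᵥ y) ≡ true → x ≡ y
=ᵥ-sound h = toWitness (Equivalence.from T-≡ h)

=ᵥ-complete : ∀ {x y} → x ≡ y → (x =ᵥ y) ≡ true
=ᵥ-complete e = Equivalence.to T-≡ (fromWitness e)

-- Quantifiers over Bool and over bit vectors Bool^n, computed as Booleans;
-- their soundness turns a closed computation into a universal or existential fact.

everyB someB : (Bool → Bool) → Bool
everyB p = p false ∧ p true
someB p = p false ∨ p true

everyVec someVec : ∀ n → (Vec Bool n → Bool) → Bool
everyVec zero p = p []
everyVec (suc n) p = everyB λ x → everyVec n (p ∘ (x ∷_))
someVec zero p = p []
someVec (suc n) p = someB λ x → someVec n (p ∘ (x ∷_))

everyB-sound : ∀ {p} → everyB p ≡ true → ∀ x → p x ≡ true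
everyB-sound h false = ∧-conicalˡ _ _ h
everyB-sound h true = ∧-conicalʳ _ _ h

everyB-complete : ∀ {p} → (∀ x → p x ≡ true) → everyB p ≡ true
everyB-complete f = ∧-intro (f false) (f true)

someB-sound : ∀ {p} → someB p ≡ true → Σ Bool λ x → p x ≡ true
someB-sound h with ∨-elim h
... | inj₁ t = false , t
... | inj₂ t = true , t

someB-complete : ∀ {p} x → p x ≡ true → someB p ≡ true
someB-complete {p} false t = ∨-introˡ (p true) t
someB-complete {p} true t = ∨-introʳ (p false) t

everyVec-sound : ∀ n {p} → everyVec n p ≡ true → ∀ v → p v ≡ true
everyVec-sound zero h [] = h
everyVec-sound (suc n) {p} h (x ∷ v) =
  everyVec-sound n (everyB-sound {λ x → everyVec n (p ∘ (x ∷_))} h x) v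

everyVec-complete : ∀ n {p} → (∀ v → p v ≡ true) → everyVec n p ≡ true
everyVec-complete zero f = f []
everyVec-complete (suc n) f = everyB-complete λ x → everyVec-complete n (f ∘ (x ∷_))

someVec-sound : ∀ n {p} → someVec n p ≡ true → Σ (Vec Bool n) λ v → p v ≡ true
someVec-sound zero h = [] , h
someVec-sound (suc n) {p} h with someB-sound {λ x → someVec n (p ∘ (x ∷_))} h
... | x , hx with someVec-sound n hx
... | v , hv = x ∷ v , hv

someVec-complete : ∀ n {p} v → p v ≡ true → someVec n p ≡ true
someVec-complete zero [] t = t
someVec-complete (suc n) {p} (x ∷ v) t =
  someB-complete {λ x → someVec n (p ∘ (x ∷_))} x (someVec-complete n v t)

everyV someV : (V → Bool) → Bool
everyV = everyVec 4
someV = someVec 4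

pointwise-check : ∀ {f g : V → Bool} → everyV (λ v → f v ≡ᵇ g v) ≡ true → ∀ v → f v ≡ g v
pointwise-check {f} {g} h v = ≡ᵇ-sound (everyVec-sound 4 {λ v → f v ≡ᵇ g v} h v)

pointwise-check₂ : ∀ {f g : V → V → Bool} →
  everyV (λ x → everyV λ y → f x y ≡ᵇ g x y) ≡ true → ∀ x y → f x y ≡ g x y
pointwise-check₂ {f} {g} h x =
  pointwise-check (everyVec-sound 4 {λ x → everyV λ y → f x y ≡ᵇ g x y} h x)

vertex-check : ∀ {f g : V → V} → everyV (λ v → f v =ᵥ g v) ≡ true → ∀ v → f v ≡ g v
vertex-check {f} {g} h v = =ᵥ-sound (everyVec-sound 4 {λ v → f v =ᵥ g v} h v)

someV-cong : ∀ {p q} → (∀ z → p z ≡ q z) → someV p ≡ someV q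
someV-cong {p} {q} e = bool-ext (transport p q e) (transport q p (sym ∘ e))
  where
    transport : ∀ p q → (∀ z → p z ≡ q z) → someV p ≡ true → someV q ≡ true
    transport p q e h with someVec-sound 4 {p} h
    ... | z , pz = someVec-complete 4 {q} z (trans (sym (e z)) pz)

0ᵥ : V
0ᵥ = b false false false false

⊕-assoc : ∀ x y z → (x ⊕ y) ⊕ z ≡ x ⊕ (y ⊕ z)
⊕-assoc = zipWith-assoc xor-assoc

⊕-comm : ∀ x y → x ⊕ y ≡ y ⊕ x
⊕-comm = zipWith-comm xor-comm

⊕-identityˡ : ∀ x → 0ᵥ ⊕ x ≡ x
⊕-identityˡ (_ ∷ _ ∷ _ ∷ _ ∷ []) = refl

⊕-identityʳ : ∀ x → x ⊕ 0ᵥ ≡ x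
⊕-identityʳ x = trans (⊕-comm x 0ᵥ) (⊕-identityˡ x)

⊕-self : ∀ x → x ⊕ x ≡ 0ᵥ
⊕-self (w ∷ x ∷ y ∷ z ∷ []) rewrite xor-same w | xor-same x | xor-same y | xor-same z = refl

⊕-cancelˡ : ∀ a x → a ⊕ (a ⊕ x) ≡ x
⊕-cancelˡ a x = begin
  a ⊕ (a ⊕ x)  ≡⟨ ⊕-assoc a a x ⟨
  (a ⊕ a) ⊕ x  ≡⟨ cong (_⊕ x) (⊕-self a) ⟩
  0ᵥ ⊕ x       ≡⟨ ⊕-identityˡ x ⟩
  x            ∎

⊕-translate : ∀ a x y → (a ⊕ x) ⊕ (a ⊕ y) ≡ x ⊕ y
⊕-translate a x y = begin
  (a ⊕ x) ⊕ (a ⊕ y)  ≡⟨ cong (_⊕ (a ⊕ y)) (⊕-comm a x) ⟩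
  (x ⊕ a) ⊕ (a ⊕ y)  ≡⟨ ⊕-assoc x a (a ⊕ y) ⟩
  x ⊕ (a ⊕ (a ⊕ y))  ≡⟨ cong (x ⊕_) (⊕-cancelˡ a y) ⟩
  x ⊕ y              ∎

⊕-telescope : ∀ x y z → (x ⊕ y) ⊕ (y ⊕ z) ≡ x ⊕ z
⊕-telescope x y z = trans (⊕-assoc x y (y ⊕ z)) (cong (x ⊕_) (⊕-cancelˡ y z))

adj : V → V → Bool
adj x y = (x ⊕ y) ∈ᵇ S

_·_ : Aut → V → V
g · x = Inverse.to (Aut.perm g) x

_⁻¹·_ : Aut → V → V
g ⁻¹· y = Inverse.from (Aut.perm g) y

·-⁻¹· : ∀ g y → g · (g ⁻¹· y) ≡ y
·-⁻¹· g = Inverse.strictlyInverseˡ (Aut.perm g)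

⁻¹·-· : ∀ g x → g ⁻¹· (g · x) ≡ x
⁻¹·-· g = Inverse.strictlyInverseʳ (Aut.perm g)

·-injective : ∀ g {x y} → g · x ≡ g · y → x ≡ y
·-injective g {x} {y} e = begin
  x               ≡⟨ ⁻¹·-· g x ⟨
  g ⁻¹· (g · x)   ≡⟨ cong (g ⁻¹·_) e ⟩
  g ⁻¹· (g · y)   ≡⟨ ⁻¹·-· g y ⟩
  y               ∎

adj-preserved : ∀ g x y → adj (g · x) (g · y) ≡ adj x y
adj-preserved g x y = bool-ext
  (∈ᵇ-complete ∘ Equivalence.from (Aut.preserves g x y) ∘ ∈ᵇ-sound)
  (∈ᵇ-complete ∘ Equivalence.to (Aut.preserves g x y) ∘ ∈ᵇ-sound)

mkAut : (f f⁻¹ : V → V) → (∀ y → f (f⁻¹ y) ≡ y) → (∀ x → f⁻¹ (f x) ≡ x) →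
        (∀ x y → adj (f x) (f y) ≡ adj x y) → Aut
mkAut f f⁻¹ inverseˡ inverseʳ pres = record
  { perm = mk↔ₛ′ f f⁻¹ inverseˡ inverseʳ
  ; preserves = λ x y → mk⇔ (λ a → ∈ᵇ-sound (trans (pres x y) (∈ᵇ-complete a)))
                             (λ a → ∈ᵇ-sound (trans (sym (pres x y)) (∈ᵇ-complete a)))
  }

_⁻¹ : Aut → Aut
g ⁻¹ = mkAut (g ⁻¹·_) (g ·_) (⁻¹·-· g) (·-⁻¹· g) pres
  where
    pres : ∀ x y → adj (g ⁻¹· x) (g ⁻¹· y) ≡ adj x y
    pres x y = trans (sym (adj-preserved g (g ⁻¹· x) (g ⁻¹· y))) (cong₂ adj (·-⁻¹· g x) (·-⁻¹· g y))

-- AQ₄ is a Cayley graph of ℤ₂⁴, so every translation is an automorphism.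
translation : V → Aut
translation a = mkAut (a ⊕_) (a ⊕_) (⊕-cancelˡ a) (⊕-cancelˡ a)
  (λ x y → cong (_∈ᵇ S) (⊕-translate a x y))

involution : (σ : V → V) → (∀ x → σ (σ x) ≡ x) → (∀ x y → adj (σ x) (σ y) ≡ adj x y) → Aut
involution σ σσ = mkAut σ σ σσ σσ

Invariant : (V → V → Bool) → Set
Invariant R = ∀ g x y → R (g · x) (g · y) ≡ R x y

invariant-cong : ∀ {R R′} → (∀ x y → R x y ≡ R′ x y) → Invariant R → Invariant R′
invariant-cong {R} {R′} R≗R′ inv g x y = begin
  R′ (g · x) (g · y)  ≡⟨ R≗R′ (g · x) (g · y) ⟨
  R (g · x) (g · y)   ≡⟨ inv g x y ⟩
  R x y               ≡⟨ R≗R′ x y ⟩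
  R′ x y              ∎

=ᵥ-invariant : Invariant _=ᵥ_
=ᵥ-invariant g x y = bool-ext
  (λ e → =ᵥ-complete (·-injective g (=ᵥ-sound e)))
  (λ e → =ᵥ-complete (cong (g ·_) (=ᵥ-sound e)))

-- Existential quantification over a vertex commutes with the action of an automorphism;
-- this is what makes relations defined by "there is a vertex z with ..." invariant.
someV-reindex : ∀ g (p : V → Bool) {q} → (∀ z → p (g · z) ≡ q z) → someV p ≡ someV q
someV-reindex g p {q} e = bool-ext to from
  where
    to : someV p ≡ true → someV q ≡ true
    to h with someVec-sound 4 {p} h
    ... | z , pz = someVec-complete 4 {q} (g ⁻¹· z)
                     (trans (sym (e (g ⁻¹· z))) (subst (λ u → p u ≡ true) (sym (·-⁻¹· g z)) pz))
    from : someV q ≡ true → someV p ≡ true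
    from h with someVec-sound 4 {q} h
    ... | z , qz = someVec-complete 4 {p} (g · z) (trans (e z) qz)

Diff : List V → V → V → Bool
Diff L x y = (x ⊕ y) ∈ᵇ L

-- Since translations are automorphisms, an invariant relation is determined by the
-- neighbourhood it assigns to the vertex 0: it is the difference relation of that set.
invariant-is-diff : ∀ {R} L → Invariant R → (∀ v → R 0ᵥ v ≡ v ∈ᵇ L) → ∀ x y → R x y ≡ Diff L x y
invariant-is-diff {R} L inv at0 x y = begin
  R x y              ≡⟨ inv (translation x) x y ⟨
  R (x ⊕ x) (x ⊕ y)  ≡⟨ cong (λ u → R u (x ⊕ y)) (⊕-self x) ⟩
  R 0ᵥ (x ⊕ y)       ≡⟨ at0 (x ⊕ y) ⟩
  Diff L x y         ∎

Closed : Subset → Set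
Closed P = ∀ x y → P x ≡ true → P y ≡ true → P (x ⊕ y) ≡ true

closedᵇ : Subset → Bool
closedᵇ P = everyV λ x → everyV λ y → (P x ∧ P y) ⇒ᵇ P (x ⊕ y)

closedᵇ-sound : ∀ P → closedᵇ P ≡ true → Closed P
closedᵇ-sound P h x y px py =
  ⇒ᵇ-elim (everyVec-sound 4 {λ y → (P x ∧ P y) ⇒ᵇ P (x ⊕ y)}
             (everyVec-sound 4 {λ x → everyV λ y → (P x ∧ P y) ⇒ᵇ P (x ⊕ y)} h x) y)
          (∧-intro px py)

closedᵇ-complete : ∀ P → Closed P → closedᵇ P ≡ true
closedᵇ-complete P cl = everyVec-complete 4 λ x → everyVec-complete 4 λ y →
  ⇒ᵇ-intro (P x ∧ P y) λ h → cl x y (∧-conicalˡ _ _ h) (∧-conicalʳ _ _ h)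

closed-cong : ∀ {P Q} → (∀ v → P v ≡ Q v) → Closed P → Closed Q
closed-cong {P} {Q} P≗Q cl x y qx qy =
  trans (sym (P≗Q (x ⊕ y))) (cl x y (trans (P≗Q x) qx) (trans (P≗Q y) qy))

block-image : ∀ {Δ} → IsBlock Δ → ∀ g x → x ∈ₛ Δ → (g · x) ∈ₛ Δ → ∀ y → y ∈ₛ Δ → (g · y) ∈ₛ Δ
block-image B g x x∈Δ gx∈Δ y y∈Δ with B g
... | inj₁ Δᵍ≡Δ = Equivalence.to (Δᵍ≡Δ (g · y)) (y , y∈Δ , refl)
... | inj₂ Δᵍ∩Δ≡∅ = ⊥-elim (Δᵍ∩Δ≡∅ (g · x) (x , x∈Δ , refl) gx∈Δ)

-- A block through 0 is closed under ⊕: translate by any of its points.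
block-closed : ∀ {Δ} → IsBlock Δ → 0ᵥ ∈ₛ Δ → Closed Δ
block-closed {Δ} B 0∈Δ x y x∈Δ y∈Δ =
  block-image B (translation x) 0ᵥ 0∈Δ (subst (_∈ₛ Δ) (sym (⊕-identityʳ x)) x∈Δ) y y∈Δ

block-stable : ∀ {Δ} → IsBlock Δ → 0ᵥ ∈ₛ Δ → ∀ g → g · 0ᵥ ≡ 0ᵥ → ∀ v → Δ (g · v) ≡ Δ v
block-stable {Δ} B 0∈Δ g g0≡0 v = bool-ext
  (λ gv∈Δ → subst (_∈ₛ Δ) (⁻¹·-· g v)
     (block-image B (g ⁻¹) 0ᵥ 0∈Δ (subst (_∈ₛ Δ) (sym g⁻¹0≡0) 0∈Δ) (g · v) gv∈Δ))
  (block-image B g 0ᵥ 0∈Δ (subst (_∈ₛ Δ) (sym g0≡0) 0∈Δ) v)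
  where
    g⁻¹0≡0 : g ⁻¹· 0ᵥ ≡ 0ᵥ
    g⁻¹0≡0 = trans (cong (g ⁻¹·_) (sym g0≡0)) (⁻¹·-· g 0ᵥ)

Symmetric Transitive : (V → V → Bool) → Set
Symmetric R = ∀ x y → R x y ≡ true → R y x ≡ true
Transitive R = ∀ x y z → R x y ≡ true → R y z ≡ true → R x z ≡ true

class-is-block : ∀ {R} → Invariant R → Symmetric R → Transitive R →
                 ∀ c {Δ} → (∀ v → Δ v ≡ R c v) → IsBlock Δ
class-is-block {R} inv R-sym R-trans c {Δ} Δ≡Rc g with R c (g · c) in c~gc
... | true = inj₁ λ y → mk⇔ (into y) (onto y)
  where
    into : ∀ y → y ∈img[ Δ , g ] → y ∈ₛ Δ
    into _ (x , x∈Δ , refl) = trans (Δ≡Rc (g · x))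
      (R-trans c (g · c) (g · x) c~gc (trans (inv g c x) (trans (sym (Δ≡Rc x)) x∈Δ)))
    onto : ∀ y → y ∈ₛ Δ → y ∈img[ Δ , g ]
    onto y y∈Δ = g ⁻¹· y , trans (Δ≡Rc (g ⁻¹· y)) c~x , ·-⁻¹· g y
      where
        gc~y : R (g · c) (g · (g ⁻¹· y)) ≡ true
        gc~y = subst (λ u → R (g · c) u ≡ true) (sym (·-⁻¹· g y))
          (R-trans (g · c) c y (R-sym c (g · c) c~gc) (trans (sym (Δ≡Rc y)) y∈Δ))
        c~x : R c (g ⁻¹· y) ≡ true
        c~x = trans (sym (inv g c (g ⁻¹· y))) gc~y
... | false = inj₂ disjoint
  where
    disjoint : ImgDisj Δ g
    disjoint _ (x , x∈Δ , refl) gx∈Δ = ⊥-elim (false≢true (trans (sym c~gc) c~gc′))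
      where
        c~gc′ : R c (g · c) ≡ true
        c~gc′ = R-trans c (g · x) (g · c) (trans (sym (Δ≡Rc (g · x))) gx∈Δ)
          (R-sym (g · c) (g · x) (trans (inv g c x) (trans (sym (Δ≡Rc x)) x∈Δ)))

-- The difference relation of a ⊕-closed set is an equivalence relation, so if it is
-- invariant then the set itself (the class of 0) is a block.
subgroup-is-block : ∀ L → Closed (_∈ᵇ L) → Invariant (Diff L) → ∀ {Δ} → (∀ v → Δ v ≡ v ∈ᵇ L) → IsBlock Δ
subgroup-is-block L cl inv Δ≗L = class-is-block inv diff-sym diff-trans 0ᵥ
  (λ v → trans (Δ≗L v) (cong (_∈ᵇ L) (sym (⊕-identityˡ v))))
  where
    diff-sym : Symmetric (Diff L)
    diff-sym x y = subst (λ d → d ∈ᵇ L ≡ true) (⊕-comm x y)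
    diff-trans : Transitive (Diff L)
    diff-trans x y z x~y y~z = subst (λ d → d ∈ᵇ L ≡ true) (⊕-telescope x y z) (cl _ _ x~y y~z)

common : V → V → V → Bool
common x y z = adj x z ∧ adj y z

apartCommon : V → V → V → V → Bool
apartCommon x y z₁ z₂ = common x y z₁ ∧ common x y z₂ ∧ not (adj z₁ z₂) ∧ not (z₁ =ᵥ z₂)

Heavy : V → V → Bool
Heavy x y = adj x y ∧ someV λ z₁ → someV λ z₂ → apartCommon x y z₁ z₂

Twin : V → V → Bool
Twin x y = someV λ z → Heavy x z ∧ Heavy z y

Same₄ : V → V → Bool
Same₄ x y = Twin x y ∨ Heavy x y

Light : V → V → Bool
Light x y = adj x y ∧ not (Same₄ x y)

Same₈ : V → V → Bool
Same₈ x y = Same₄ x y ∨ someV λ z → Light x z ∧ Light z y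

common-invariant : ∀ g x y z → common (g · x) (g · y) (g · z) ≡ common x y z
common-invariant g x y z = cong₂ _∧_ (adj-preserved g x z) (adj-preserved g y z)

heavy-invariant : Invariant Heavy
heavy-invariant g x y = cong₂ _∧_ (adj-preserved g x y)
  (someV-reindex g (λ z₁ → someV λ z₂ → apartCommon (g · x) (g · y) z₁ z₂) λ z₁ →
   someV-reindex g (λ z₂ → apartCommon (g · x) (g · y) (g · z₁) z₂) λ z₂ →
   cong₂ _∧_ (common-invariant g x y z₁) (cong₂ _∧_ (common-invariant g x y z₂)
     (cong₂ _∧_ (cong not (adj-preserved g z₁ z₂)) (cong not (=ᵥ-invariant g z₁ z₂)))))

twin-invariant : Invariant Twin
twin-invariant g x y = someV-reindex g (λ z → Heavy (g · x) z ∧ Heavy z (g · y)) λ z →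
  cong₂ _∧_ (heavy-invariant g x z) (heavy-invariant g z y)

same₄-invariant : Invariant Same₄
same₄-invariant g x y = cong₂ _∨_ (twin-invariant g x y) (heavy-invariant g x y)

light-invariant : Invariant Light
light-invariant g x y = cong₂ _∧_ (adj-preserved g x y) (cong not (same₄-invariant g x y))

same₈-invariant : Invariant Same₈
same₈-invariant g x y = cong₂ _∨_ (same₄-invariant g x y)
  (someV-reindex g (λ z → Light (g · x) z ∧ Light z (g · y)) λ z →
   cong₂ _∧_ (light-invariant g x z) (light-invariant g z y))

heavyDiffs lightDiffs : List V
heavyDiffs = b false false true true ∷ b false true true true ∷ []
lightDiffs = b true false false false ∷ b false false true false ∷ b false false false true ∷
             b true true true true ∷ []

heavy-diff : ∀ x y → Heavy x y ≡ Diff heavyDiffs x y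
heavy-diff = invariant-is-diff heavyDiffs heavy-invariant (pointwise-check refl)

heavy-heavy-from-0 : ∀ v → (someV λ z → Diff heavyDiffs 0ᵥ z ∧ Diff heavyDiffs z v) ≡ v ∈ᵇ B2
heavy-heavy-from-0 = pointwise-check refl

B2-∪-heavy : ∀ d → (d ∈ᵇ B2 ∨ d ∈ᵇ heavyDiffs) ≡ d ∈ᵇ B4
B2-∪-heavy = pointwise-check refl

S-∖-B4 : ∀ d → (d ∈ᵇ S ∧ not (d ∈ᵇ B4)) ≡ d ∈ᵇ lightDiffs
S-∖-B4 = pointwise-check refl

B4-∪-light-light-from-0 :
  ∀ v → (Diff B4 0ᵥ v ∨ someV λ z → Diff lightDiffs 0ᵥ z ∧ Diff lightDiffs z v) ≡ v ∈ᵇ B8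
B4-∪-light-light-from-0 = pointwise-check refl

twin-diff : ∀ x y → Twin x y ≡ Diff B2 x y
twin-diff = invariant-is-diff B2 twin-invariant λ v →
  trans (someV-cong λ z → cong₂ _∧_ (heavy-diff 0ᵥ z) (heavy-diff z v)) (heavy-heavy-from-0 v)

same₄-diff : ∀ x y → Same₄ x y ≡ Diff B4 x y
same₄-diff x y = trans (cong₂ _∨_ (twin-diff x y) (heavy-diff x y)) (B2-∪-heavy (x ⊕ y))

light-diff : ∀ x y → Light x y ≡ Diff lightDiffs x y
light-diff x y = trans (cong (λ s → adj x y ∧ not s) (same₄-diff x y)) (S-∖-B4 (x ⊕ y))

same₈-diff : ∀ x y → Same₈ x y ≡ Diff B8 x y
same₈-diff = invariant-is-diff B8 same₈-invariant λ v →
  trans (cong₂ _∨_ (same₄-diff 0ᵥ v) (someV-cong λ z → cong₂ _∧_ (light-diff 0ᵥ z) (light-diff z v)))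
        (B4-∪-light-light-from-0 v)

≐-pointwise : ∀ {Δ L} → Δ ≐ L → ∀ v → Δ v ≡ v ∈ᵇ L
≐-pointwise Δ≐L v = bool-ext (∈ᵇ-complete ∘ Equivalence.to (Δ≐L v)) (Equivalence.from (Δ≐L v) ∘ ∈ᵇ-sound)

pointwise-≐ : ∀ {Δ L} → (∀ v → Δ v ≡ v ∈ᵇ L) → Δ ≐ L
pointwise-≐ Δ≗L v = mk⇔ (λ p → ∈ᵇ-sound (trans (sym (Δ≗L v)) p)) (λ p → trans (Δ≗L v) (∈ᵇ-complete p))

card-cong : ∀ {Δ Δ′} → (∀ v → Δ v ≡ Δ′ v) → card Δ ≡ card Δ′
card-cong {Δ} {Δ′} Δ≗Δ′ = cong length (filter-≐ (λ v → Δ v Bool.≟ true) (λ v → Δ′ v Bool.≟ true)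
  ((λ {v} p → trans (sym (Δ≗Δ′ v)) p) , (λ {v} p → trans (Δ≗Δ′ v) p)) allV)

nontrivial-subgroup-block : ∀ L → Closed (_∈ᵇ L) → Invariant (Diff L) →
  1 < card (_∈ᵇ L) → card (_∈ᵇ L) < 16 → ∀ {Δ} → Δ ≐ L → IsNontrivialBlock Δ
nontrivial-subgroup-block L cl inv 1<∣L∣ ∣L∣<16 Δ≐L =
  subgroup-is-block L cl inv Δ≗L , subst (1 <_) (sym ∣Δ∣≡∣L∣) 1<∣L∣ , subst (_< 16) (sym ∣Δ∣≡∣L∣) ∣L∣<16
  where
    Δ≗L = ≐-pointwise Δ≐L
    ∣Δ∣≡∣L∣ = card-cong Δ≗L

σ₁ σ₂ σ₃ : V → V
σ₁ (w ∷ x ∷ y ∷ z ∷ []) = w ∷ (w xor x) ∷ (w xor y) ∷ (w xor z) ∷ []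
σ₂ (w ∷ x ∷ y ∷ z ∷ []) = w ∷ x ∷ z ∷ y ∷ []
σ₃ (w ∷ x ∷ y ∷ z ∷ []) = (y xor z) ∷ (x xor y) ∷ y ∷ (w xor y) ∷ []

σ₁-aut σ₂-aut σ₃-aut : Aut
σ₁-aut = involution σ₁ (vertex-check refl) (pointwise-check₂ refl)
σ₂-aut = involution σ₂ (vertex-check refl) (pointwise-check₂ refl)
σ₃-aut = involution σ₃ (vertex-check refl) (pointwise-check₂ refl)

-- The orbits of the group ⟨σ₁, σ₂, σ₃⟩ on V, with a representative for each.
data Orbit : Set where
  O₀ O₁ O₂ O₃ O₄ O₅ : Orbit

orbitOf : V → Orbit
orbitOf (false ∷ false ∷ false ∷ false ∷ []) = O₀
orbitOf (false ∷ false ∷ false ∷ true  ∷ []) = O₁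
orbitOf (false ∷ false ∷ true  ∷ false ∷ []) = O₁
orbitOf (true  ∷ false ∷ false ∷ false ∷ []) = O₁
orbitOf (true  ∷ true  ∷ true  ∷ true  ∷ []) = O₁
orbitOf (false ∷ false ∷ true  ∷ true  ∷ []) = O₂
orbitOf (false ∷ true  ∷ true  ∷ true  ∷ []) = O₂
orbitOf (false ∷ true  ∷ false ∷ false ∷ []) = O₃
orbitOf (false ∷ true  ∷ false ∷ true  ∷ []) = O₄
orbitOf (false ∷ true  ∷ true  ∷ false ∷ []) = O₄
orbitOf (true  ∷ false ∷ true  ∷ true  ∷ []) = O₄
orbitOf (true  ∷ true  ∷ false ∷ false ∷ []) = O₄
orbitOf (true  ∷ false ∷ false ∷ true  ∷ []) = O₅
orbitOf (true  ∷ false ∷ true  ∷ false ∷ []) = O₅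
orbitOf (true  ∷ true  ∷ false ∷ true  ∷ []) = O₅
orbitOf (true  ∷ true  ∷ true  ∷ false ∷ []) = O₅

representative : Orbit → V
representative O₀ = 0ᵥ
representative O₁ = b false false false true
representative O₂ = b false false true true
representative O₃ = b false true false false
representative O₄ = b false true false true
representative O₅ = b true false false true

-- A set invariant under σ₁, σ₂, σ₃ takes the same value along each orbit
-- (each vertex is reached from its representative by a word in the σᵢ).
orbit-constant : ∀ (Δ : Subset) → (∀ v → Δ (σ₁ v) ≡ Δ v) → (∀ v → Δ (σ₂ v) ≡ Δ v) →
                 (∀ v → Δ (σ₃ v) ≡ Δ v) → ∀ v → Δ v ≡ Δ (representative (orbitOf v))
orbit-constant Δ s₁ s₂ s₃ (false ∷ false ∷ false ∷ false ∷ []) = refl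
orbit-constant Δ s₁ s₂ s₃ (false ∷ false ∷ false ∷ true  ∷ []) = refl
orbit-constant Δ s₁ s₂ s₃ (false ∷ false ∷ true  ∷ false ∷ []) = s₂ (b false false false true)
orbit-constant Δ s₁ s₂ s₃ (true  ∷ false ∷ false ∷ false ∷ []) = s₃ (b false false false true)
orbit-constant Δ s₁ s₂ s₃ (true  ∷ true  ∷ true  ∷ true  ∷ []) =
  trans (s₁ (b true false false false)) (s₃ (b false false false true))
orbit-constant Δ s₁ s₂ s₃ (false ∷ false ∷ true  ∷ true  ∷ []) = refl
orbit-constant Δ s₁ s₂ s₃ (false ∷ true  ∷ true  ∷ true  ∷ []) = s₃ (b false false true true)
orbit-constant Δ s₁ s₂ s₃ (false ∷ true  ∷ false ∷ false ∷ []) = refl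
orbit-constant Δ s₁ s₂ s₃ (false ∷ true  ∷ false ∷ true  ∷ []) = refl
orbit-constant Δ s₁ s₂ s₃ (false ∷ true  ∷ true  ∷ false ∷ []) = s₂ (b false true false true)
orbit-constant Δ s₁ s₂ s₃ (true  ∷ true  ∷ false ∷ false ∷ []) = s₃ (b false true false true)
orbit-constant Δ s₁ s₂ s₃ (true  ∷ false ∷ true  ∷ true  ∷ []) =
  trans (s₁ (b true true false false)) (s₃ (b false true false true))
orbit-constant Δ s₁ s₂ s₃ (true  ∷ false ∷ false ∷ true  ∷ []) = refl
orbit-constant Δ s₁ s₂ s₃ (true  ∷ false ∷ true  ∷ false ∷ []) = s₂ (b true false false true)
orbit-constant Δ s₁ s₂ s₃ (true  ∷ true  ∷ true  ∷ false ∷ []) = s₁ (b true false false true)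
orbit-constant Δ s₁ s₂ s₃ (true  ∷ true  ∷ false ∷ true  ∷ []) =
  trans (s₁ (b true false true false)) (s₂ (b true false false true))

select : Vec Bool 5 → Orbit → Bool
select _ O₀ = true
select (o₁ ∷ _) O₁ = o₁
select (_ ∷ o₂ ∷ _) O₂ = o₂
select (_ ∷ _ ∷ o₃ ∷ _) O₃ = o₃
select (_ ∷ _ ∷ _ ∷ o₄ ∷ _) O₄ = o₄
select (_ ∷ _ ∷ _ ∷ _ ∷ o₅ ∷ _) O₅ = o₅

orbitUnion : Vec Bool 5 → Subset
orbitUnion os v = select os (orbitOf v)

profile : Subset → Vec Bool 5
profile Δ = Δ (representative O₁) ∷ Δ (representative O₂) ∷ Δ (representative O₃) ∷
            Δ (representative O₄) ∷ Δ (representative O₅) ∷ []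

profile-select : ∀ {Δ} → 0ᵥ ∈ₛ Δ → ∀ o → Δ (representative o) ≡ select (profile Δ) o
profile-select 0∈Δ O₀ = 0∈Δ
profile-select _ O₁ = refl
profile-select _ O₂ = refl
profile-select _ O₃ = refl
profile-select _ O₄ = refl
profile-select _ O₅ = refl

stable-is-orbitUnion : ∀ (Δ : Subset) → 0ᵥ ∈ₛ Δ → (∀ v → Δ (σ₁ v) ≡ Δ v) → (∀ v → Δ (σ₂ v) ≡ Δ v) →
                       (∀ v → Δ (σ₃ v) ≡ Δ v) → ∀ v → Δ v ≡ orbitUnion (profile Δ) v
stable-is-orbitUnion Δ 0∈Δ s₁ s₂ s₃ v =
  trans (orbit-constant Δ s₁ s₂ s₃ v) (profile-select {Δ} 0∈Δ (orbitOf v))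

_≈ᵇ_ : Subset → List V → Bool
P ≈ᵇ L = everyV λ v → P v ≡ᵇ v ∈ᵇ L

classifiedᵇ : Subset → Bool
classifiedᵇ P = closedᵇ P ⇒ᵇ ((card P <ᵇ 2) ∨ (16 ≤ᵇ card P) ∨ P ≈ᵇ B2 ∨ P ≈ᵇ B4 ∨ P ≈ᵇ B8)

orbitUnions-classified : ∀ os → classifiedᵇ (orbitUnion os) ≡ true
orbitUnions-classified = everyVec-sound 5 {classifiedᵇ ∘ orbitUnion} refl

classified-closed : ∀ P → classifiedᵇ P ≡ true → Closed P → 1 < card P → card P < 16 →
  (∀ v → P v ≡ v ∈ᵇ B2) ⊎ (∀ v → P v ≡ v ∈ᵇ B4) ⊎ (∀ v → P v ≡ v ∈ᵇ B8)
classified-closed P h cl 1<∣P∣ ∣P∣<16 with ∨-elim (⇒ᵇ-elim h (closedᵇ-complete P cl))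
... | inj₁ small = ⊥-elim (<⇒≱ (<ᵇ⇒< (card P) 2 (Equivalence.from T-≡ small)) 1<∣P∣)
... | inj₂ rest with ∨-elim rest
... | inj₁ large = ⊥-elim (<⇒≱ ∣P∣<16 (≤ᵇ⇒≤ 16 (card P) (Equivalence.from T-≡ large)))
... | inj₂ listed =
  Sum.map pointwise-check (Sum.map pointwise-check pointwise-check ∘ ∨-elim) (∨-elim listed)

-- Every nontrivial block through 0 is B2, B4 or B8: it is ⊕-closed and a union of
-- stabiliser orbits, and the computation above lists all such sets.
block-classification : ∀ {Δ} → IsBlock Δ → 0ᵥ ∈ₛ Δ → 1 < card Δ → card Δ < 16 →
                       (Δ ≐ B2) ⊎ (Δ ≐ B4) ⊎ (Δ ≐ B8)
block-classification {Δ} B 0∈Δ 1<∣Δ∣ ∣Δ∣<16 =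
  Sum.map as-list (Sum.map as-list as-list)
    (classified-closed P (orbitUnions-classified (profile Δ)) (closed-cong Δ≗P (block-closed B 0∈Δ))
      (subst (1 <_) ∣Δ∣≡∣P∣ 1<∣Δ∣) (subst (_< 16) ∣Δ∣≡∣P∣ ∣Δ∣<16))
  where
    P : Subset
    P = orbitUnion (profile Δ)
    Δ≗P : ∀ v → Δ v ≡ P v
    Δ≗P = stable-is-orbitUnion Δ 0∈Δ (block-stable B 0∈Δ σ₁-aut refl)
            (block-stable B 0∈Δ σ₂-aut refl) (block-stable B 0∈Δ σ₃-aut refl)
    ∣Δ∣≡∣P∣ : card Δ ≡ card P
    ∣Δ∣≡∣P∣ = card-cong Δ≗P
    as-list : ∀ {L} → (∀ v → P v ≡ v ∈ᵇ L) → Δ ≐ L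
    as-list P≗L = pointwise-≐ λ v → trans (Δ≗P v) (P≗L v)

B2-closed : Closed (_∈ᵇ B2)
B2-closed = closedᵇ-sound _ refl

B4-closed : Closed (_∈ᵇ B4)
B4-closed = closedᵇ-sound _ refl

B8-closed : Closed (_∈ᵇ B8)
B8-closed = closedᵇ-sound _ refl

B2-invariant : Invariant (Diff B2)
B2-invariant = invariant-cong twin-diff twin-invariant

B4-invariant : Invariant (Diff B4)
B4-invariant = invariant-cong same₄-diff same₄-invariant

B8-invariant : Invariant (Diff B8)
B8-invariant = invariant-cong same₈-diff same₈-invariant

mainTheorem13 : ∀ (Δ : Subset) → b false false false false ∈ₛ Δ →
    (IsNontrivialBlock Δ ⇔ ((Δ ≐ B2) ⊎ (Δ ≐ B4) ⊎ (Δ ≐ B8)))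
mainTheorem13 Δ 0∈Δ =
  mk⇔ (λ { (B , 1<∣Δ∣ , ∣Δ∣<16) → block-classification B 0∈Δ 1<∣Δ∣ ∣Δ∣<16 }) candidate
  where
    candidate : (Δ ≐ B2) ⊎ (Δ ≐ B4) ⊎ (Δ ≐ B8) → IsNontrivialBlock Δ
    candidate (inj₁ Δ≐B2) =
      nontrivial-subgroup-block B2 B2-closed B2-invariant (<ᵇ⇒< 1 2 _) (<ᵇ⇒< 2 16 _) Δ≐B2
    candidate (inj₂ (inj₁ Δ≐B4)) =
      nontrivial-subgroup-block B4 B4-closed B4-invariant (<ᵇ⇒< 1 4 _) (<ᵇ⇒< 4 16 _) Δ≐B4
    candidate (inj₂ (inj₂ Δ≐B8)) =
      nontrivial-subgroup-block B8 B8-closed B8-invariant (<ᵇ⇒< 1 8 _) (<ᵇ⇒< 8 16 _) Δ≐B8
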